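{- Let $G$ be an acyclically oriented simple graph and $H$ a simple undirected graph. Let $\Sigma$ be the set of all acyclic orientations of the edges of $H$, and for $\sigma\in\Sigma$ let $H_\sigma$ be the dag obtained by orienting $H$ according to $\sigma$. Then $\hom(H,G)=\sum_{\sigma\in\Sigma}\hom(H_\sigma,G)$, where on the left $\hom(H,G)$ counts homomorphisms from $H$ to the underlying undirected graph of $G$, and on the right $\hom(H_\sigma,G)$ counts direction-preserving homomorphisms from the dag $H_\sigma$ to $G$.
   Context: A homomorphism from an undirected graph $H$ to an undirected graph is a map on nodes sending edges to edges; for directed graphs it must send each arc $(u,v)$ to an arc $(\phi(u),\phi(v))$. Orientations in $\Sigma$ are counted as distinct assignments of directions to the (labelled) edges of $H$. -}

module Defs where

open import Data.Nat using (ℕ)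
open import Data.Bool using (Bool; true)
open import Data.Fin using (Fin)
open import Data.Vec using (Vec; lookup)
open import Data.List using (List)
open import Data.List.Membership.Propositional using (_∈_)
open import Data.List.Relation.Unary.Unique.Propositional using (Unique)
open import Data.Product using (_×_)
open import Data.Sum using (_⊎_)
open import Relation.Nullary using (¬_)
open import Relation.Binary.PropositionalEquality using (_≡_)
open import Function.Bundles using (_⇔_)

-- A (di)graph on the labelled vertex set Fin k is given by its
-- adjacency matrix (a concrete vector of vectors, so ≡ is the right equality).
Mat : ℕ → Set
Mat k = Vec (Vec Bool k) k

Adj : ∀ {k} → Mat k → Fin k → Fin k → Set
Adj A u v = lookup (lookup A u) v ≡ true

IsSimpleGraph : ∀ {k} → Mat k → Set
IsSimpleGraph A = (∀ u v → Adj A u v → Adj A v u) × (∀ u → ¬ Adj A u u)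

data DPath {k} (A : Mat k) : Fin k → Fin k → Set where
  arc  : ∀ {u v} → Adj A u v → DPath A u v
  step : ∀ {u w v} → Adj A u w → DPath A w v → DPath A u v

IsAcyclic : ∀ {k} → Mat k → Set
IsAcyclic A = ∀ u → ¬ DPath A u u

IsOrientation : ∀ {k} → Mat k → Mat k → Set
IsOrientation H D =
  (∀ u v → Adj D u v → Adj H u v) ×
  (∀ u v → Adj H u v → Adj D u v ⊎ Adj D v u) ×
  (∀ u v → Adj D u v → ¬ Adj D v u)

IsAcyclicOrientation : ∀ {k} → Mat k → Mat k → Set
IsAcyclicOrientation H D = IsOrientation H D × IsAcyclic D

UAdj : ∀ {n} → Mat n → Fin n → Fin n → Set
UAdj G x y = Adj G x y ⊎ Adj G y x

IsHom : ∀ {k n} → Mat k → Mat n → Vec (Fin n) k → Set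
IsHom H G f = ∀ u v → Adj H u v → UAdj G (lookup f u) (lookup f v)

IsDiHom : ∀ {k n} → Mat k → Mat n → Vec (Fin n) k → Set
IsDiHom D G f = ∀ u v → Adj D u v → Adj G (lookup f u) (lookup f v)

-- L enumerates exactly the elements satisfying P, without repetition;
-- hence length L is the number of such elements.
IsEnum : {A : Set} → (A → Set) → List A → Set
IsEnum {A} P L = Unique L × (∀ (x : A) → (x ∈ L) ⇔ P x)

module Submission where

-- Fix a homomorphism f from H to the underlying
-- undirected graph of the acyclic digraph G.  Orient every edge uv of H
-- along the arc of G between f u and f v; call this the orientation
-- induced by f.  It is well defined because G has no 2-cycles, it is
-- acyclic because a directed cycle would map to a closed walk in G, and
-- f is a direction-preserving homomorphism from it to G.  Conversely,
-- if D is any orientation of H and f : D → G is direction-preserving,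
-- then f is a homomorphism of the underlying graphs and D is forced to
-- be the orientation induced by f.  Hence the homomorphisms H → G are
-- partitioned by the acyclic orientations D of H into the blocks
-- hom(D, G), which gives the identity.

open import Defs
open import Data.Nat using (ℕ; _+_)
open import Data.Bool using (Bool; true; false; _∧_)
open import Data.Fin using (Fin)
open import Data.Vec using (Vec; lookup; tabulate)
open import Data.Vec.Properties using (lookup∘tabulate; tabulate∘lookup; tabulate-cong)
open import Data.List using (List; []; _∷_; length; map; concatMap)
open import Data.List.Properties using (length-++)
open import Data.Nat.ListAction using (sum)
open import Data.List.Relation.Unary.Any using (here; there)
open import Data.List.Relation.Unary.All as All using ()
open import Data.List.Relation.Unary.AllPairs using ([]; _∷_)
open import Data.List.Membership.Propositional using (_∈_; find; lose)
open import Data.List.Membership.Propositional.Properties using (∈-concatMap⁺; ∈-concatMap⁻)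
open import Data.List.Membership.Propositional.Properties.WithK using (unique∧set⇒bag)
open import Data.List.Relation.Unary.Unique.Propositional using (Unique)
open import Data.List.Relation.Unary.Unique.Propositional.Properties using (++⁺)
open import Data.List.Relation.Binary.BagAndSetEquality using (∼bag⇒↭)
open import Data.List.Relation.Binary.Permutation.Propositional.Properties using (↭-length)
open import Data.Product using (_×_; _,_; proj₁; proj₂; ∃)
open import Data.Sum using (inj₁; inj₂)
open import Data.Empty using (⊥-elim)
open import Relation.Nullary using (¬_)
open import Relation.Binary.PropositionalEquality using (_≡_; refl; sym; trans; cong)
open import Function using (_∘_)
open import Function.Bundles using (_⇔_; mk⇔; Equivalence)

open Equivalence using (to; from)

unique-same-members⇒same-length : {X : Set} {xs ys : List X} →
  Unique xs → Unique ys → (∀ {x} → x ∈ xs ⇔ x ∈ ys) → length xs ≡ length ys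
unique-same-members⇒same-length uxs uys same =
  ↭-length (∼bag⇒↭ (unique∧set⇒bag uxs uys same))

length-concatMap : {I X : Set} (F : I → List X) (is : List I) →
  length (concatMap F is) ≡ sum (map (length ∘ F) is)
length-concatMap F [] = refl
length-concatMap F (i ∷ is) =
  trans (length-++ (F i)) (cong (length (F i) +_) (length-concatMap F is))

concatMap-unique : {I X : Set} (F : I → List X) (is : List I) → Unique is →
  (∀ {i} → i ∈ is → Unique (F i)) →
  (∀ {i j x} → i ∈ is → j ∈ is → x ∈ F i → x ∈ F j → i ≡ j) →
  Unique (concatMap F is)
concatMap-unique F [] _ _ _ = []
concatMap-unique F (i ∷ is) (i∉is ∷ uis) uF disjoint =
  ++⁺ (uF (here refl))
      (concatMap-unique F is uis (uF ∘ there) (λ p q → disjoint (there p) (there q)))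
      not-in-both
  where
  not-in-both : ∀ {x} → ¬ (x ∈ F i × x ∈ concatMap F is)
  not-in-both (x∈Fi , x∈rest) with find (∈-concatMap⁻ F x∈rest)
  ... | j , j∈is , x∈Fj = All.lookup i∉is j∈is (disjoint (here refl) (there j∈is) x∈Fi x∈Fj)

count-by-blocks : {I X : Set} (P : X → Set) (L : List X) → IsEnum P L →
  (F : I → List X) (is : List I) → Unique is →
  (∀ {i} → i ∈ is → Unique (F i)) →
  (∀ {i j x} → i ∈ is → j ∈ is → x ∈ F i → x ∈ F j → i ≡ j) →
  (∀ x → P x ⇔ ∃ λ i → i ∈ is × x ∈ F i) →
  length L ≡ sum (map (length ∘ F) is)
count-by-blocks P L (uL , enumL) F is uis uF disjoint partition =
  trans (unique-same-members⇒same-length uL (concatMap-unique F is uis uF disjoint)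
           (λ {x} → mk⇔ (into x) (outof x)))
        (length-concatMap F is)
  where
  into : ∀ x → x ∈ L → x ∈ concatMap F is
  into x x∈L with to (partition x) (to (enumL x) x∈L)
  ... | i , i∈is , x∈Fi = ∈-concatMap⁺ F (lose i∈is x∈Fi)

  outof : ∀ x → x ∈ concatMap F is → x ∈ L
  outof x x∈C = from (enumL x) (from (partition x) (find (∈-concatMap⁻ F x∈C)))

matrix : ∀ {k} → (Fin k → Fin k → Bool) → Mat k
matrix a = tabulate (λ u → tabulate (a u))

matrix-entry : ∀ {k} (a : Fin k → Fin k → Bool) u v → lookup (lookup (matrix a) u) v ≡ a u v
matrix-entry a u v = trans (cong (λ row → lookup row v) (lookup∘tabulate _ u)) (lookup∘tabulate (a u) v)

bool-ext : {a b : Bool} → (a ≡ true → b ≡ true) → (b ≡ true → a ≡ true) → a ≡ b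
bool-ext {false} {false} _ _ = refl
bool-ext {false} {true}  _ a⇐b = a⇐b refl
bool-ext {true}  {false} a⇒b _ = sym (a⇒b refl)
bool-ext {true}  {true}  _ _ = refl

Adj-ext : ∀ {k} (A B : Mat k) → (∀ u v → Adj A u v ⇔ Adj B u v) → A ≡ B
Adj-ext A B same =
  trans (sym (tabulate∘lookup A)) (trans (tabulate-cong rows) (tabulate∘lookup B))
  where
  rows : ∀ u → lookup A u ≡ lookup B u
  rows u = trans (sym (tabulate∘lookup (lookup A u)))
    (trans (tabulate-cong (λ v → bool-ext (to (same u v)) (from (same u v))))
           (tabulate∘lookup (lookup B u)))

∧-true⇔ : {a b : Bool} → (a ∧ b) ≡ true ⇔ (a ≡ true × b ≡ true)
∧-true⇔ = mk⇔ split (λ (p , q) → join p q)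
  where
  split : ∀ {a b} → (a ∧ b) ≡ true → a ≡ true × b ≡ true
  split {true} {true} refl = refl , refl

  join : ∀ {a b} → a ≡ true → b ≡ true → (a ∧ b) ≡ true
  join refl refl = refl

acyclic⇒asymmetric : ∀ {n} {G : Mat n} → IsAcyclic G → ∀ x y → Adj G x y → ¬ Adj G y x
acyclic⇒asymmetric acyclic x y xy yx = acyclic x (step xy (arc yx))

map-DPath : ∀ {k n} {D : Mat k} {G : Mat n} (φ : Fin k → Fin n) →
  (∀ u v → Adj D u v → Adj G (φ u) (φ v)) → ∀ {u v} → DPath D u v → DPath G (φ u) (φ v)
map-DPath φ hom (arc {u} {v} uv) = arc (hom u v uv)
map-DPath φ hom (step {u} {w} uw walk) = step (hom u w uw) (map-DPath φ hom walk)

diHom-reflects-acyclic : ∀ {k n} (D : Mat k) (G : Mat n) (f : Vec (Fin n) k) →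
  IsDiHom D G f → IsAcyclic G → IsAcyclic D
diHom-reflects-acyclic D G f hom acyclic u cycle = acyclic (lookup f u) (map-DPath (lookup f) hom cycle)

module Induced {k n} (H : Mat k) (G : Mat n) where

  induced : Vec (Fin n) k → Mat k
  induced f = matrix (λ u v → lookup (lookup H u) v ∧ lookup (lookup G (lookup f u)) (lookup f v))

  Adj-induced : ∀ f u v → Adj (induced f) u v ⇔ (Adj H u v × Adj G (lookup f u) (lookup f v))
  Adj-induced f u v = mk⇔ (to ∧-true⇔ ∘ trans (sym (matrix-entry _ u v)))
                          (trans (matrix-entry _ u v) ∘ from ∧-true⇔)

  induced-isDiHom : ∀ f → IsDiHom (induced f) G f
  induced-isDiHom f u v = proj₂ ∘ to (Adj-induced f u v)

  induced-isAcyclicOrientation : IsSimpleGraph H → IsAcyclic G →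
    ∀ f → IsHom H G f → IsAcyclicOrientation H (induced f)
  induced-isAcyclicOrientation (symmetric , _) acyclic f hom =
    (sub , covers , antisym) , diHom-reflects-acyclic (induced f) G f (induced-isDiHom f) acyclic
    where
    sub : ∀ u v → Adj (induced f) u v → Adj H u v
    sub u v = proj₁ ∘ to (Adj-induced f u v)

    covers : ∀ u v → Adj H u v → UAdj (induced f) u v
    covers u v uv with hom u v uv
    ... | inj₁ fu→fv = inj₁ (from (Adj-induced f u v) (uv , fu→fv))
    ... | inj₂ fv→fu = inj₂ (from (Adj-induced f v u) (symmetric u v uv , fv→fu))

    antisym : ∀ u v → Adj (induced f) u v → ¬ Adj (induced f) v u
    antisym u v uv vu = acyclic⇒asymmetric acyclic _ _
      (induced-isDiHom f u v uv) (induced-isDiHom f v u vu)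

  diHom⇒hom : ∀ D f → IsOrientation H D → IsDiHom D G f → IsHom H G f
  diHom⇒hom D f (_ , covers , _) dihom u v uv with covers u v uv
  ... | inj₁ u→v = inj₁ (dihom u v u→v)
  ... | inj₂ v→u = inj₂ (dihom v u v→u)

  -- An orientation D of H admitting f as a direction-preserving map into
  -- G is the one induced by f: an edge cannot be reversed, because G has
  -- no 2-cycles.
  orientation-determined : IsAcyclic G → ∀ D f → IsOrientation H D → IsDiHom D G f →
    D ≡ induced f
  orientation-determined acyclic D f (sub , covers , _) dihom =
    Adj-ext D (induced f) (λ u v → mk⇔ (λ u→v → from (Adj-induced f u v) (sub u v u→v , dihom u v u→v))
                                       (forced u v ∘ to (Adj-induced f u v)))
    where
    forced : ∀ u v → Adj H u v × Adj G (lookup f u) (lookup f v) → Adj D u v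
    forced u v (uv , fu→fv) with covers u v uv
    ... | inj₁ u→v = u→v
    ... | inj₂ v→u = ⊥-elim (acyclic⇒asymmetric acyclic _ _ fu→fv (dihom v u v→u))

lemmaA5 : (k n : ℕ) (H : Mat k) (G : Mat n) →
    IsSimpleGraph H → IsAcyclic G →
    (homs : List (Vec (Fin n) k)) → IsEnum (IsHom H G) homs →
    (Σor : List (Mat k)) → IsEnum (IsAcyclicOrientation H) Σor →
    (dihoms : Mat k → List (Vec (Fin n) k)) →
    (∀ D → D ∈ Σor → IsEnum (IsDiHom D G) (dihoms D)) →
    length homs ≡ sum (map (λ D → length (dihoms D)) Σor)
lemmaA5 k n H G simple acyclic homs enumHoms Σor (uΣ , enumΣ) dihoms enumDiHoms =
  count-by-blocks (IsHom H G) homs enumHoms dihoms Σor uΣ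
    (λ D∈Σ → proj₁ (enumDiHoms _ D∈Σ)) disjoint partition
  where
  open Induced H G

  orientation : ∀ {D} → D ∈ Σor → IsOrientation H D
  orientation {D} = proj₁ ∘ to (enumΣ D)

  isDiHom : ∀ {D f} → D ∈ Σor → f ∈ dihoms D → IsDiHom D G f
  isDiHom {D} {f} D∈Σ = to (proj₂ (enumDiHoms D D∈Σ) f)

  -- Both orientations are induced by f.
  disjoint : ∀ {D D′ f} → D ∈ Σor → D′ ∈ Σor → f ∈ dihoms D → f ∈ dihoms D′ → D ≡ D′
  disjoint {D} {D′} {f} D∈Σ D′∈Σ f∈D f∈D′ =
    trans (orientation-determined acyclic D f (orientation D∈Σ) (isDiHom D∈Σ f∈D))
      (sym (orientation-determined acyclic D′ f (orientation D′∈Σ) (isDiHom D′∈Σ f∈D′)))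

  -- A homomorphism lies in the block of its induced orientation.
  partition : ∀ f → IsHom H G f ⇔ ∃ λ D → D ∈ Σor × f ∈ dihoms D
  partition f = mk⇔
    (λ hom → let D∈Σ = from (enumΣ (induced f)) (induced-isAcyclicOrientation simple acyclic f hom)
             in induced f , D∈Σ , from (proj₂ (enumDiHoms _ D∈Σ) f) (induced-isDiHom f))
    (λ (D , D∈Σ , f∈D) → diHom⇒hom D f (orientation D∈Σ) (isDiHom D∈Σ f∈D))
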